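{- For every $k$-graph $F$ there are $C=C(F)$ and $\varepsilon=\varepsilon(F)>0$ such that, if $L$ is the core of $F$ and $\ell=|V(L)|$, then every $k$-graph on $n\ge C$ vertices containing at least $n^{\ell-\varepsilon}$ copies of $L$ contains a copy of $F$.
   Context: A homomorphism from a $k$-graph $G$ to a $k$-graph $F$ is a map $V(G)\to V(F)$ sending edges to edges. A $k$-graph $L$ is a core of $F$ if (i) there is a homomorphism from $F$ to $L$, (ii) $L$ is a subgraph of $F$, and (iii) $L$ has the smallest number of vertices among all $k$-graphs satisfying (i) and (ii); all cores of $F$ are isomorphic, and this is called the core of $F$. A copy of $L$ means a subgraph isomorphic to $L$. -}

module Defs where

open import Data.Nat using (ℕ; _≤_)
open import Data.Bool using (Bool; true; false)
open import Data.Fin using (Fin; _≟_)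
open import Data.Fin.Subset using (Subset; _∈_; ∣_∣)
open import Data.Fin.Subset.Properties using (_∈?_)
open import Data.Fin.Properties using (any?)
open import Data.Vec using (tabulate)
open import Data.Product using (Σ; ∃; _×_; _,_)
open import Relation.Nullary using (¬_)
open import Relation.Nullary.Decidable using (⌊_⌋; _×-dec_)
open import Relation.Binary.PropositionalEquality using (_≡_)
open import Function.Definitions using (Injective)
open import Function.Bundles using (_⇔_)

record KGraph (k : ℕ) : Set where
  field
    v       : ℕ
    edge    : Subset v → Bool
    uniform : ∀ e → edge e ≡ true → ∣ e ∣ ≡ k
open KGraph public

image : ∀ {a b} → (Fin a → Fin b) → Subset a → Subset b
image {a} φ e = tabulate λ j → ⌊ any? (λ i → (i ∈? e) ×-dec (φ i ≟ j)) ⌋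

IsHom : ∀ {k} (G F : KGraph k) → (Fin (v G) → Fin (v F)) → Set
IsHom G F φ = ∀ e → edge G e ≡ true → edge F (image φ e) ≡ true

Hom : ∀ {k} (G F : KGraph k) → Set
Hom G F = Σ (Fin (v G) → Fin (v F)) (IsHom G F)

record Subgraph {k} (G : KGraph k) : Set where
  field
    W      : Subset (v G)
    E'     : Subset (v G) → Bool
    E'⊆E   : ∀ f → E' f ≡ true → edge G f ≡ true
    inside : ∀ f → E' f ≡ true → ∀ x → x ∈ f → x ∈ W
open Subgraph public

IsoTo : ∀ {k} (L : KGraph k) {G : KGraph k} → Subgraph G → Set
IsoTo L {G} H =
  Σ (Fin (v L) → Fin (v G)) λ φ →
    Injective _≡_ _≡_ φ
    × (∀ x → (x ∈ W H) ⇔ (∃ λ i → φ i ≡ x))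
    × (∀ e → edge L e ≡ E' H (image φ e))

Copy : ∀ {k} (L G : KGraph k) → Set
Copy L G = Σ (Subgraph G) (IsoTo L)

-- two copies are the same iff they are the same subgraph
SameSubgraph : ∀ {k} {G : KGraph k} → Subgraph G → Subgraph G → Set
SameSubgraph H₁ H₂ = (W H₁ ≡ W H₂) × (∀ f → E' H₁ f ≡ E' H₂ f)

AtLeastCopies : ∀ {k} → ℕ → (L G : KGraph k) → Set
AtLeastCopies m L G =
  Σ (Fin m → Copy L G) λ c →
    ∀ i j → SameSubgraph (Σ.proj₁ (c i)) (Σ.proj₁ (c j)) → i ≡ j

IsCore : ∀ {k} (L F : KGraph k) → Set
IsCore {k} L F =
  Hom F L × Copy L F
  × (∀ (L' : KGraph k) → Hom F L' → Copy L' F → v L ≤ v L')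

-- Write n = |V(G)|, f = |V(F)|, ℓ = |V(L)|, t = f + 1, and fix a homomorphism h : F → L
-- (of the core property only h and ℓ ≤ f are used). Listing the vertices of each copy of L
-- gives a set S ⊆ [n]^ℓ of at least n^(ℓ - 1/Q) tuples. Erdős's box theorem, proved by
-- induction on ℓ through the power-mean inequality, finds t-sets T₁, …, T_ℓ of vertices of G
-- with T₁ × ⋯ × T_ℓ ⊆ S, so every transversal of the box spans a copy of L. Sending a vertex
-- x of F to the x-th element of T_{h(x)} is injective, and it maps each edge e of F into a
-- single transversal (h is injective on e because h(e) is an edge of L), so it embeds F in G.
module Submission where

open import Defs
open import Data.Bool using (Bool; true; false; _∧_; _∨_; not; if_then_else_)
open import Data.Bool.Properties using (∨-zeroʳ; ∧-identityʳ; ⇔→≡)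
open import Data.Empty using (⊥-elim)
open import Data.Fin using (Fin; zero; suc; _≟_; fromℕ<)
open import Data.Fin.Properties as Fin using (any?; injective⇒≤; ¬Fin0)
open import Data.Fin.Subset using (Subset; _∈_; _⊆_; ∣_∣; ⊥; ⊤; ⁅_⁆; _∪_; _-_)
open import Data.Fin.Subset.Properties
  using (_∈?_; _⊆?_; ∈⊤; ⊆-refl; ⊆-antisym; p⊆q⇒∣p∣≤∣q∣; ∣p∣≤∣x∷p∣; ∣⊥∣≡0; ∣⁅x⁆∣≡1; x∈⁅x⁆; x∈p∪q⁺;
         x∈p∧x≢y⇒x∈p-y; x∈p⇒∣p-x∣<∣p∣)
open import Data.List using (List; []; _∷_; _++_; map; length; allFin; cartesianProductWith)
open import Data.List.Properties using (map-tabulate; length-tabulate; length-++; length-map)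
open import Data.List.Membership.Propositional using () renaming (_∈_ to _∈ˡ_)
open import Data.List.Membership.Propositional.Properties using (∈-allFin; ∈-cartesianProductWith⁺)
open import Data.List.Relation.Unary.Any using (here; there)
open import Data.Nat hiding (_≟_; ∣_-_∣)
open import Data.Nat.Properties hiding (_≟_)
open import Algebra.Properties.CommutativeSemigroup +-commutativeSemigroup
  using () renaming (interchange to +-interchange)
open import Algebra.Properties.CommutativeSemigroup *-commutativeSemigroup
  using (x∙yz≈y∙xz) renaming (interchange to *-interchange)
open import Data.Nat.Tactic.RingSolver using (solve-∀)
open import Data.Product using (Σ; ∃; _×_; _,_; proj₁; proj₂)
open import Data.Sum using (inj₁; inj₂)
open import Data.Vec using (Vec; []; _∷_; lookup; tabulate; replicate; here; there)
open import Data.Vec.Properties using (lookup∘tabulate; []=⇒lookup; lookup⇒[]=; ≡-dec)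
open import Function using (_∘_; id)
open import Function.Bundles using (mk⇔; Equivalence)
open import Function.Definitions using (Injective)
open import Relation.Binary.Definitions using (DecidableEquality)
open import Relation.Binary.PropositionalEquality
open import Relation.Nullary using (Dec; yes; no; does; contradiction)
open import Relation.Nullary.Decidable using (_×-dec_; dec-true; dec-false; isYes≗does)

does⇒witness : ∀ {p} {P : Set p} (P? : Dec P) → does P? ≡ true → P
does⇒witness (yes p) _ = p

𝟙 : Bool → ℕ
𝟙 true  = 1
𝟙 false = 0

𝟙≤1 : ∀ b → 𝟙 b ≤ 1
𝟙≤1 true  = ≤-refl
𝟙≤1 false = z≤n

𝟙>0⇒true : ∀ b → 0 < 𝟙 b → b ≡ true
𝟙>0⇒true true _ = refl

𝟙-∧ : ∀ a b → 𝟙 (a ∧ b) ≡ 𝟙 a * 𝟙 b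
𝟙-∧ true  b = sym (+-identityʳ (𝟙 b))
𝟙-∧ false b = refl

𝟙-∨ : ∀ a b → 𝟙 (a ∨ b) ≤ 𝟙 a + 𝟙 b
𝟙-∨ true  b = s≤s z≤n
𝟙-∨ false b = ≤-refl

𝟙-∨-split : ∀ a b → 𝟙 (a ∨ b) ≡ 𝟙 b + 𝟙 (a ∧ not b)
𝟙-∨-split true  true  = refl
𝟙-∨-split true  false = refl
𝟙-∨-split false b     = sym (+-identityʳ (𝟙 b))

𝟙-not-∧ : ∀ a b → 𝟙 (not (not a ∧ b)) ≤ 𝟙 a + 𝟙 (not b)
𝟙-not-∧ true  b     = s≤s z≤n
𝟙-not-∧ false true  = z≤n
𝟙-not-∧ false false = ≤-refl

module _ {a} {A : Set a} where

  ∑ : List A → (A → ℕ) → ℕ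
  ∑ []       f = 0
  ∑ (x ∷ xs) f = f x + ∑ xs f

  ∑-syntax : List A → (A → ℕ) → ℕ
  ∑-syntax = ∑

  infix 5 ∑-syntax
  syntax ∑-syntax xs (λ x → e) = ∑[ x ← xs ] e

  ∑-cong : ∀ xs {f g : A → ℕ} → (∀ x → f x ≡ g x) → ∑ xs f ≡ ∑ xs g
  ∑-cong []       f≗g = refl
  ∑-cong (x ∷ xs) f≗g = cong₂ _+_ (f≗g x) (∑-cong xs f≗g)

  ∑-mono-≤ : ∀ xs {f g : A → ℕ} → (∀ x → f x ≤ g x) → ∑ xs f ≤ ∑ xs g
  ∑-mono-≤ []       f≤g = z≤n
  ∑-mono-≤ (x ∷ xs) f≤g = +-mono-≤ (f≤g x) (∑-mono-≤ xs f≤g)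

  ∑-distrib-+ : ∀ xs (f g : A → ℕ) → ∑[ x ← xs ] (f x + g x) ≡ ∑ xs f + ∑ xs g
  ∑-distrib-+ []       f g = refl
  ∑-distrib-+ (x ∷ xs) f g =
    trans (cong (f x + g x +_) (∑-distrib-+ xs f g)) (+-interchange (f x) (g x) _ _)

  ∑-*ˡ : ∀ xs c (f : A → ℕ) → ∑[ x ← xs ] (c * f x) ≡ c * ∑ xs f
  ∑-*ˡ []       c f = sym (*-zeroʳ c)
  ∑-*ˡ (x ∷ xs) c f =
    trans (cong (c * f x +_) (∑-*ˡ xs c f)) (sym (*-distribˡ-+ c (f x) (∑ xs f)))

  ∑-*ʳ : ∀ xs c (f : A → ℕ) → ∑[ x ← xs ] (f x * c) ≡ ∑ xs f * c
  ∑-*ʳ xs c f = begin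
    ∑[ x ← xs ] (f x * c) ≡⟨ ∑-cong xs (λ x → *-comm (f x) c) ⟩
    ∑[ x ← xs ] (c * f x) ≡⟨ ∑-*ˡ xs c f ⟩
    c * ∑ xs f            ≡⟨ *-comm c (∑ xs f) ⟩
    ∑ xs f * c            ∎
    where open ≡-Reasoning

  ∑-const : ∀ xs c → ∑[ _ ← xs ] c ≡ length xs * c
  ∑-const []       c = refl
  ∑-const (x ∷ xs) c = cong (c +_) (∑-const xs c)

  ∑-zero : ∀ xs → ∑[ _ ← xs ] 0 ≡ 0
  ∑-zero xs = trans (∑-const xs 0) (*-zeroʳ (length xs))

  ∑-++ : ∀ xs ys (f : A → ℕ) → ∑ (xs ++ ys) f ≡ ∑ xs f + ∑ ys f
  ∑-++ []       ys f = refl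
  ∑-++ (x ∷ xs) ys f = trans (cong (f x +_) (∑-++ xs ys f)) (sym (+-assoc (f x) _ _))

  ∈⇒≤∑ : ∀ {xs x} (f : A → ℕ) → x ∈ˡ xs → f x ≤ ∑ xs f
  ∈⇒≤∑ f (here refl)          = m≤m+n _ _
  ∈⇒≤∑ {y ∷ _} f (there x∈xs) = ≤-trans (∈⇒≤∑ f x∈xs) (m≤n+m _ (f y))

  ∃-≥-average : A → ∀ xs (f : A → ℕ) → ∃ λ x → ∑ xs f ≤ length xs * f x
  ∃-≥-average x₀ []       f = x₀ , z≤n
  ∃-≥-average x₀ (x ∷ xs) f with ∃-≥-average x₀ xs f
  ... | y , ∑≤ with f x ≤? f y
  ...   | yes fx≤fy = y , +-mono-≤ fx≤fy ∑≤
  ...   | no  fx≰fy = x , +-monoʳ-≤ (f x) (≤-trans ∑≤ (*-monoʳ-≤ (length xs) (<⇒≤ (≰⇒> fx≰fy))))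

module _ {a b} {A : Set a} {B : Set b} where

  ∑-map : ∀ (g : A → B) xs (f : B → ℕ) → ∑ (map g xs) f ≡ ∑[ x ← xs ] f (g x)
  ∑-map g []       f = refl
  ∑-map g (x ∷ xs) f = cong (f (g x) +_) (∑-map g xs f)

  ∑-comm : ∀ xs ys (f : A → B → ℕ) → (∑[ x ← xs ] ∑[ y ← ys ] f x y) ≡ (∑[ y ← ys ] ∑[ x ← xs ] f x y)
  ∑-comm []       ys f = sym (∑-zero ys)
  ∑-comm (x ∷ xs) ys f =
    trans (cong (∑ ys (f x) +_) (∑-comm xs ys f)) (sym (∑-distrib-+ ys (f x) _))

  ∑∑-distrib-+ : ∀ xs ys (f g : A → B → ℕ) →
    (∑[ x ← xs ] ∑[ y ← ys ] (f x y + g x y)) ≡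
    (∑[ x ← xs ] ∑[ y ← ys ] f x y) + (∑[ x ← xs ] ∑[ y ← ys ] g x y)
  ∑∑-distrib-+ xs ys f g = trans (∑-cong xs λ x → ∑-distrib-+ ys (f x) (g x)) (∑-distrib-+ xs _ _)

module _ {a} {A : Set a} (_≟ᴬ_ : DecidableEquality A) {xs : List A} (complete : ∀ v → v ∈ˡ xs) where

  count-image : ∀ m (g : Fin m → A) → Injective _≡_ _≡_ g → m ≤ ∑[ v ← xs ] 𝟙 (does (any? λ i → g i ≟ᴬ v))
  count-image zero    g g-inj = z≤n
  count-image (suc m) g g-inj = begin
    suc m
      ≡⟨ +-comm 1 m ⟩
    m + 1
      ≤⟨ +-mono-≤ (count-image m (g ∘ suc) (Fin.suc-injective ∘ g-inj))
                  (≤-trans (≤-reflexive (sym new-at-g₀)) (∈⇒≤∑ new (complete (g zero)))) ⟩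
    ∑ xs (𝟙 ∘ hit′) + ∑ xs new
      ≡⟨ ∑-distrib-+ xs (𝟙 ∘ hit′) new ⟨
    ∑[ v ← xs ] (𝟙 (hit′ v) + new v)
      ≡⟨ ∑-cong xs (λ v → 𝟙-∨-split (does (g zero ≟ᴬ v)) (hit′ v)) ⟨
    ∑[ v ← xs ] 𝟙 (does (g zero ≟ᴬ v) ∨ hit′ v) ∎
    where
    open ≤-Reasoning
    hit′ : A → Bool
    hit′ v = does (any? λ i → g (suc i) ≟ᴬ v)
    new : A → ℕ
    new v = 𝟙 (does (g zero ≟ᴬ v) ∧ not (hit′ v))
    new-at-g₀ : new (g zero) ≡ 1
    new-at-g₀ rewrite dec-true (g zero ≟ᴬ g zero) refl
                    | dec-false (any? λ i → g (suc i) ≟ᴬ g zero) (λ (_ , eq) → Fin.0≢1+n (sym (g-inj eq)))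
                    = refl

∑-allFin-suc : ∀ n (f : Fin (suc n) → ℕ) → ∑ (allFin (suc n)) f ≡ f zero + (∑[ i ← allFin n ] f (suc i))
∑-allFin-suc n f =
  cong (f zero +_) (trans (cong (λ is → ∑ is f) (sym (map-tabulate id suc))) (∑-map suc (allFin n) f))

length-allFin : ∀ n → length (allFin n) ≡ n
length-allFin n = length-tabulate id

∑-δ : ∀ {n} (a : Fin n) → ∑[ j ← allFin n ] 𝟙 (does (a ≟ j)) ≡ 1
∑-δ {suc n} zero    = trans (∑-allFin-suc n λ j → 𝟙 (does (zero ≟ j))) (cong suc (∑-zero (allFin n)))
∑-δ {suc n} (suc a) = trans (∑-allFin-suc n λ j → 𝟙 (does (suc a ≟ j))) (∑-δ a)

ordered-rearrangement : ∀ {a b c d} → a ≤ b → c ≤ d → a * d + b * c ≤ a * c + b * d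
ordered-rearrangement {a} {c = c} a≤b c≤d with m≤n⇒∃[o]m+o≡n a≤b | m≤n⇒∃[o]m+o≡n c≤d
... | e , refl | f , refl = ≤-trans (m≤m+n _ (e * f)) (≤-reflexive (expand a c e f))
  where
  expand : ∀ a c e f → a * (c + f) + (a + e) * c + e * f ≡ a * c + (a + e) * (c + f)
  expand = solve-∀

rearrangement : ∀ k a b → a * b ^ k + b * a ^ k ≤ a * a ^ k + b * b ^ k
rearrangement k a b with ≤-total a b
... | inj₁ a≤b = ordered-rearrangement a≤b (^-monoˡ-≤ k a≤b)
... | inj₂ b≤a = subst₂ _≤_ (+-comm (b * a ^ k) _) (+-comm (b * b ^ k) _)
                   (ordered-rearrangement b≤a (^-monoˡ-≤ k b≤a))

module _ {a} {A : Set a} where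

  ∑∑-* : ∀ xs (u v : A → ℕ) → (∑[ x ← xs ] ∑[ y ← xs ] u x * v y) ≡ ∑ xs u * ∑ xs v
  ∑∑-* xs u v = trans (∑-cong xs λ x → ∑-*ˡ xs (u x) v) (∑-*ʳ xs (∑ xs v) u)

  chebyshev : ∀ k xs (d : A → ℕ) →
              ∑ xs d * (∑[ x ← xs ] d x ^ k) ≤ length xs * (∑[ x ← xs ] d x ^ suc k)
  chebyshev k xs d = *-cancelˡ-≤ 2 (begin
    2 * (∑ xs d * ∑ xs e)                               ≡⟨ cross ⟨
    ∑[ x ← xs ] ∑[ y ← xs ] (d x * e y + d y * e x)      ≤⟨ ∑-mono-≤ xs (λ x → ∑-mono-≤ xs λ y →
                                                           rearrangement k (d x) (d y)) ⟩
    ∑[ x ← xs ] ∑[ y ← xs ] (w x + w y)                  ≡⟨ diagonal ⟩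
    2 * (length xs * ∑ xs w)                            ∎)
    where
    open ≤-Reasoning
    e w : A → ℕ
    e x = d x ^ k
    w x = d x ^ suc k
    double : ∀ m → m + m ≡ 2 * m
    double m = cong (m +_) (sym (+-identityʳ m))
    cross : (∑[ x ← xs ] ∑[ y ← xs ] (d x * e y + d y * e x)) ≡ 2 * (∑ xs d * ∑ xs e)
    cross = begin-equality
      ∑[ x ← xs ] ∑[ y ← xs ] (d x * e y + d y * e x)
        ≡⟨ ∑∑-distrib-+ xs xs _ _ ⟩
      (∑[ x ← xs ] ∑[ y ← xs ] d x * e y) + (∑[ x ← xs ] ∑[ y ← xs ] d y * e x)
        ≡⟨ cong₂ _+_ (∑∑-* xs d e) (trans (∑-comm xs xs λ x y → d y * e x) (∑∑-* xs d e)) ⟩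
      ∑ xs d * ∑ xs e + ∑ xs d * ∑ xs e
        ≡⟨ double (∑ xs d * ∑ xs e) ⟩
      2 * (∑ xs d * ∑ xs e) ∎
    diagonal : (∑[ x ← xs ] ∑[ y ← xs ] (w x + w y)) ≡ 2 * (length xs * ∑ xs w)
    diagonal = begin-equality
      ∑[ x ← xs ] ∑[ y ← xs ] (w x + w y)
        ≡⟨ ∑∑-distrib-+ xs xs _ _ ⟩
      (∑[ x ← xs ] ∑[ _ ← xs ] w x) + (∑[ _ ← xs ] ∑ xs w)
        ≡⟨ cong₂ _+_ (trans (∑-cong xs λ x → ∑-const xs (w x)) (∑-*ˡ xs (length xs) w))
                     (∑-const xs (∑ xs w)) ⟩
      length xs * ∑ xs w + length xs * ∑ xs w
        ≡⟨ double (length xs * ∑ xs w) ⟩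
      2 * (length xs * ∑ xs w) ∎

  power-mean : ∀ s xs (d : A → ℕ) → ∑ xs d ^ suc s ≤ length xs ^ s * (∑[ x ← xs ] d x ^ suc s)
  power-mean zero    xs d = ≤-reflexive (trans (*-identityʳ _)
                              (sym (trans (+-identityʳ _) (∑-cong xs λ x → *-identityʳ (d x)))))
  power-mean (suc s) xs d = begin
    D * D ^ suc s                                  ≤⟨ *-monoʳ-≤ D (power-mean s xs d) ⟩
    D * (L ^ s * (∑[ x ← xs ] d x ^ suc s))        ≡⟨ x∙yz≈y∙xz D (L ^ s) _ ⟩
    L ^ s * (D * (∑[ x ← xs ] d x ^ suc s))        ≤⟨ *-monoʳ-≤ (L ^ s) (chebyshev (suc s) xs d) ⟩
    L ^ s * (L * (∑[ x ← xs ] d x ^ suc (suc s)))  ≡⟨ x∙yz≈y∙xz (L ^ s) L _ ⟩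
    L * (L ^ s * (∑[ x ← xs ] d x ^ suc (suc s)))  ≡⟨ *-assoc L _ _ ⟨
    L * L ^ s * (∑[ x ← xs ] d x ^ suc (suc s))    ∎
    where
    open ≤-Reasoning
    D L : ℕ
    D = ∑ xs d
    L = length xs

module _ {a b c} {A : Set a} {B : Set b} {C : Set c} (g : A → B → C) where

  ∑-cartesianProductWith : ∀ xs ys (f : C → ℕ) →
    ∑ (cartesianProductWith g xs ys) f ≡ (∑[ x ← xs ] ∑[ y ← ys ] f (g x y))
  ∑-cartesianProductWith []       ys f = refl
  ∑-cartesianProductWith (x ∷ xs) ys f =
    trans (∑-++ (map (g x) ys) _ f) (cong₂ _+_ (∑-map (g x) ys f) (∑-cartesianProductWith xs ys f))

  length-cartesianProductWith : ∀ xs ys → length (cartesianProductWith g xs ys) ≡ length xs * length ys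
  length-cartesianProductWith []       ys = refl
  length-cartesianProductWith (x ∷ xs) ys =
    trans (length-++ (map (g x) ys)) (cong₂ _+_ (length-map (g x) ys) (length-cartesianProductWith xs ys))

tuples : ∀ n ℓ → List (Vec (Fin n) ℓ)
tuples n zero    = [] ∷ []
tuples n (suc ℓ) = cartesianProductWith _∷_ (allFin n) (tuples n ℓ)

∈-tuples : ∀ {n ℓ} (τ : Vec (Fin n) ℓ) → τ ∈ˡ tuples n ℓ
∈-tuples []      = here refl
∈-tuples (a ∷ τ) = ∈-cartesianProductWith⁺ _∷_ (∈-allFin a) (∈-tuples τ)

length-tuples : ∀ n ℓ → length (tuples n ℓ) ≡ n ^ ℓ
length-tuples n zero    = refl
length-tuples n (suc ℓ) = trans (length-cartesianProductWith _∷_ (allFin n) (tuples n ℓ))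
                                (cong₂ _*_ (length-allFin n) (length-tuples n ℓ))

count : ∀ {n ℓ} → (Vec (Fin n) ℓ → Bool) → ℕ
count {n} {ℓ} S = ∑[ τ ← tuples n ℓ ] 𝟙 (S τ)

count≤ : ∀ {n ℓ} (S : Vec (Fin n) ℓ → Bool) → count S ≤ n ^ ℓ
count≤ {n} {ℓ} S = begin
  count S                  ≤⟨ ∑-mono-≤ (tuples n ℓ) (𝟙≤1 ∘ S) ⟩
  ∑[ _ ← tuples n ℓ ] 1    ≡⟨ ∑-const (tuples n ℓ) 1 ⟩
  length (tuples n ℓ) * 1  ≡⟨ *-identityʳ _ ⟩
  length (tuples n ℓ)      ≡⟨ length-tuples n ℓ ⟩
  n ^ ℓ                    ∎
  where open ≤-Reasoning

tabulate-injective : ∀ {a n} {A : Set a} {f g : Fin n → A} → tabulate f ≡ tabulate g → ∀ i → f i ≡ g i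
tabulate-injective {f = f} {g} eq i =
  trans (sym (lookup∘tabulate f i)) (trans (cong (λ τ → lookup τ i) eq) (lookup∘tabulate g i))

allᵇ : ∀ {a t} {A : Set a} → (A → Bool) → Vec A t → Bool
allᵇ g []      = true
allᵇ g (a ∷ τ) = g a ∧ allᵇ g τ

allᵇ-lookup : ∀ {a t} {A : Set a} (g : A → Bool) (τ : Vec A t) →
              allᵇ g τ ≡ true → ∀ j → g (lookup τ j) ≡ true
allᵇ-lookup g (a ∷ τ) gτ j with g a in ga
allᵇ-lookup g (a ∷ τ) gτ zero    | true = ga
allᵇ-lookup g (a ∷ τ) gτ (suc j) | true = allᵇ-lookup g τ gτ j

count-allᵇ : ∀ {n} t (g : Fin n → Bool) → count {n} {t} (allᵇ g) ≡ (∑[ a ← allFin n ] 𝟙 (g a)) ^ t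
count-allᵇ zero    g = refl
count-allᵇ {n} (suc t) g = begin
  count {n} {suc t} (allᵇ g)
    ≡⟨ ∑-cartesianProductWith _∷_ (allFin n) (tuples n t) _ ⟩
  ∑[ a ← allFin n ] ∑[ τ ← tuples n t ] 𝟙 (g a ∧ allᵇ g τ)
    ≡⟨ ∑-cong (allFin n) (λ a → ∑-cong (tuples n t) (𝟙-∧ (g a) ∘ allᵇ g)) ⟩
  ∑[ a ← allFin n ] ∑[ τ ← tuples n t ] 𝟙 (g a) * 𝟙 (allᵇ g τ)
    ≡⟨ ∑-cong (allFin n) (λ a → trans (∑-*ˡ (tuples n t) (𝟙 (g a)) _) (cong (𝟙 (g a) *_) (count-allᵇ t g))) ⟩
  ∑[ a ← allFin n ] 𝟙 (g a) * D ^ t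
    ≡⟨ ∑-*ʳ (allFin n) (D ^ t) (𝟙 ∘ g) ⟩
  D * D ^ t ∎
  where
  open ≡-Reasoning
  D : ℕ
  D = ∑[ a ← allFin n ] 𝟙 (g a)

memberᵇ : ∀ {n t} → Fin n → Vec (Fin n) t → Bool
memberᵇ a []      = false
memberᵇ a (b ∷ τ) = does (b ≟ a) ∨ memberᵇ a τ

distinctᵇ : ∀ {n t} → Vec (Fin n) t → Bool
distinctᵇ []      = true
distinctᵇ (a ∷ τ) = not (memberᵇ a τ) ∧ distinctᵇ τ

memberᵇ-lookup : ∀ {n t} (τ : Vec (Fin n) t) i → memberᵇ (lookup τ i) τ ≡ true
memberᵇ-lookup (b ∷ τ) zero    = cong (_∨ memberᵇ b τ) (dec-true (b ≟ b) refl)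
memberᵇ-lookup (b ∷ τ) (suc i) = trans (cong (does (b ≟ lookup τ i) ∨_) (memberᵇ-lookup τ i)) (∨-zeroʳ _)

distinctᵇ⇒injective : ∀ {n t} (τ : Vec (Fin n) t) → distinctᵇ τ ≡ true → Injective _≡_ _≡_ (lookup τ)
distinctᵇ⇒injective (b ∷ τ) _ {i} {j} eq with memberᵇ b τ in b∉τ | distinctᵇ τ in τ-distinct
distinctᵇ⇒injective (b ∷ τ) _ {zero}  {zero}  eq | false | true = refl
distinctᵇ⇒injective (b ∷ τ) _ {zero}  {suc j} eq | false | true =
  contradiction (trans (sym b∉τ) (subst (λ x → memberᵇ x τ ≡ true) (sym eq) (memberᵇ-lookup τ j))) λ ()
distinctᵇ⇒injective (b ∷ τ) _ {suc i} {zero}  eq | false | true =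
  contradiction (trans (sym b∉τ) (subst (λ x → memberᵇ x τ ≡ true) eq (memberᵇ-lookup τ i))) λ ()
distinctᵇ⇒injective (b ∷ τ) _ {suc i} {suc j} eq | false | true =
  cong suc (distinctᵇ⇒injective τ τ-distinct eq)

∑-memberᵇ : ∀ {n t} (τ : Vec (Fin n) t) → ∑[ a ← allFin n ] 𝟙 (memberᵇ a τ) ≤ t
∑-memberᵇ {n} []      = ≤-reflexive (∑-zero (allFin n))
∑-memberᵇ {n} (b ∷ τ) = begin
  ∑[ a ← allFin n ] 𝟙 (does (b ≟ a) ∨ memberᵇ a τ)
    ≤⟨ ∑-mono-≤ (allFin n) (λ a → 𝟙-∨ (does (b ≟ a)) (memberᵇ a τ)) ⟩
  ∑[ a ← allFin n ] (𝟙 (does (b ≟ a)) + 𝟙 (memberᵇ a τ))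
    ≡⟨ ∑-distrib-+ (allFin n) _ _ ⟩
  (∑[ a ← allFin n ] 𝟙 (does (b ≟ a))) + (∑[ a ← allFin n ] 𝟙 (memberᵇ a τ))
    ≤⟨ +-mono-≤ (≤-reflexive (∑-δ b)) (∑-memberᵇ τ) ⟩
  suc _ ∎
  where open ≤-Reasoning

count-repeating : ∀ n t → n * count {n} {t} (not ∘ distinctᵇ) ≤ t * t * n ^ t
count-repeating n zero    = ≤-reflexive (*-zeroʳ n)
count-repeating n (suc t) = begin
  n * count {n} {suc t} (not ∘ distinctᵇ)
    ≡⟨ cong (n *_) (∑-cartesianProductWith _∷_ (allFin n) (tuples n t) _) ⟩
  n * (∑[ a ← allFin n ] ∑[ τ ← tuples n t ] 𝟙 (not (not (memberᵇ a τ) ∧ distinctᵇ τ)))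
    ≤⟨ *-monoʳ-≤ n (∑-mono-≤ (allFin n) λ a → ∑-mono-≤ (tuples n t) λ τ → 𝟙-not-∧ (memberᵇ a τ) (distinctᵇ τ)) ⟩
  n * (∑[ a ← allFin n ] ∑[ τ ← tuples n t ] (𝟙 (memberᵇ a τ) + 𝟙 (not (distinctᵇ τ))))
    ≡⟨ cong (n *_) (∑∑-distrib-+ (allFin n) (tuples n t) _ _) ⟩
  n * ((∑[ a ← allFin n ] ∑[ τ ← tuples n t ] 𝟙 (memberᵇ a τ)) + (∑[ _ ← allFin n ] R))
    ≡⟨ cong₂ (λ x y → n * (x + y)) (∑-comm (allFin n) (tuples n t) _) (∑-const (allFin n) R) ⟩
  n * ((∑[ τ ← tuples n t ] ∑[ a ← allFin n ] 𝟙 (memberᵇ a τ)) + length (allFin n) * R)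
    ≤⟨ *-monoʳ-≤ n (+-mono-≤ (∑-mono-≤ (tuples n t) ∑-memberᵇ) (≤-reflexive (cong (_* R) (length-allFin n)))) ⟩
  n * ((∑[ _ ← tuples n t ] t) + n * R)
    ≡⟨ cong (λ x → n * (x + n * R)) (trans (∑-const (tuples n t) t) (cong (_* t) (length-tuples n t))) ⟩
  n * (n ^ t * t + n * R)
    ≤⟨ *-monoʳ-≤ n (+-monoʳ-≤ (n ^ t * t) (count-repeating n t)) ⟩
  n * (n ^ t * t + t * t * n ^ t)
    ≡⟨ regroup n (n ^ t) t ⟩
  (t + t * t) * (n * n ^ t)
    ≤⟨ *-monoˡ-≤ (n * n ^ t) (≤-trans (m≤n+m _ (suc t)) (≤-reflexive (square t))) ⟩
  suc t * suc t * (n * n ^ t) ∎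
  where
  open ≤-Reasoning
  R : ℕ
  R = count {n} {t} (not ∘ distinctᵇ)
  regroup : ∀ n p t → n * (p * t + t * t * p) ≡ (t + t * t) * (n * p)
  regroup = solve-∀
  square : ∀ t → suc t + (t + t * t) ≡ suc t * suc t
  square = solve-∀

^-distribʳ-* : ∀ m n o → (m * n) ^ o ≡ m ^ o * n ^ o
^-distribʳ-* m n zero    = refl
^-distribʳ-* m n (suc o) = trans (cong (m * n *_) (^-distribʳ-* m n o)) (*-interchange m n (m ^ o) (n ^ o))

^-comm : ∀ m n o → (m ^ n) ^ o ≡ (m ^ o) ^ n
^-comm m n o = trans (^-*-assoc m n o) (trans (cong (m ^_) (*-comm n o)) (sym (^-*-assoc m o n)))

m≤m^n : ∀ m n .{{_ : NonZero m}} .{{_ : NonZero n}} → m ≤ m ^ n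
m≤m^n m (suc n) = m≤m*n m (m ^ n) {{m^n≢0 m n}}

m^n≤m^[n∸1]*m : ∀ m n .{{_ : NonZero m}} → m ^ n ≤ m ^ (n ∸ 1) * m
m^n≤m^[n∸1]*m m zero    = ≤-trans (>-nonZero⁻¹ m) (≤-reflexive (sym (*-identityˡ m)))
m^n≤m^[n∸1]*m m (suc n) = ≤-reflexive (*-comm m (m ^ n))

positive-base : ∀ {m} x y Q .{{_ : NonZero m}} .{{_ : NonZero Q}} → m ≤ x ^ Q * y → 0 < x
positive-base zero    y (suc Q) m≤0 = contradiction m≤0 (<⇒≱ (>-nonZero⁻¹ _))
positive-base (suc x) y Q       _   = z<s

^-cancelˡ-≤ : ∀ a {b c} E Q .{{_ : NonZero a}} → (a * b) ^ Q ≤ (a * c) ^ Q * E → b ^ Q ≤ c ^ Q * E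
^-cancelˡ-≤ a {b} {c} E Q ab≤ac = *-cancelˡ-≤ (a ^ Q) {{m^n≢0 a Q}} (begin
  a ^ Q * b ^ Q        ≡⟨ ^-distribʳ-* a b Q ⟨
  (a * b) ^ Q          ≤⟨ ab≤ac ⟩
  (a * c) ^ Q * E      ≡⟨ cong (_* E) (^-distribʳ-* a c Q) ⟩
  a ^ Q * c ^ Q * E    ≡⟨ *-assoc (a ^ Q) (c ^ Q) E ⟩
  a ^ Q * (c ^ Q * E)  ∎)
  where open ≤-Reasoning

-- In the induction step of the box theorem, c = |S| for S ⊆ [n]^(1+ℓ), N = n^ℓ, t = 1 + s,
-- and Y is the size of the largest common link of t distinct vertices. The first
-- hypothesis says that S has density at least n^(-P/Q); the second one is the count of
-- links obtained from the power-mean inequality.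
link-density : ∀ n N c Y s P Q .{{_ : NonZero n}} .{{_ : NonZero N}} →
  (n * N) ^ Q ≤ c ^ Q * n ^ P →
  n * c ^ suc s ≤ N ^ s * n ^ suc s * (n * Y + suc s * suc s * N) →
  (n * N) ^ Q ≤ (n * Y + suc s * suc s * N) ^ Q * n ^ (P * suc s)
link-density n N c Y s P Q dense links = ^-cancelˡ-≤ K (n ^ (P * t)) Q {{K≢0}} (begin
  (K * (n * N)) ^ Q              ≡⟨ cong (_^ Q) unfold ⟩
  (n * (n * N) ^ t) ^ Q          ≡⟨ ^-distribʳ-* n _ Q ⟩
  n ^ Q * ((n * N) ^ t) ^ Q      ≡⟨ cong (n ^ Q *_) (^-comm (n * N) t Q) ⟩
  n ^ Q * ((n * N) ^ Q) ^ t      ≤⟨ *-monoʳ-≤ (n ^ Q) (^-monoˡ-≤ t dense) ⟩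
  n ^ Q * (c ^ Q * n ^ P) ^ t    ≡⟨ regroup ⟩
  (n * c ^ t) ^ Q * n ^ (P * t)  ≤⟨ *-monoˡ-≤ (n ^ (P * t)) (^-monoˡ-≤ Q links) ⟩
  (K * Z) ^ Q * n ^ (P * t)      ∎)
  where
  open ≤-Reasoning
  t K Z : ℕ
  t = suc s
  K = N ^ s * n ^ t
  Z = n * Y + t * t * N
  K≢0 : NonZero K
  K≢0 = m*n≢0 (N ^ s) (n ^ t) {{m^n≢0 N s}} {{m^n≢0 n t}}
  unfold : K * (n * N) ≡ n * (n * N) ^ t
  unfold = trans (shape (N ^ s) (n ^ t) n N) (cong (n *_) (sym (^-distribʳ-* n N t)))
    where
    shape : ∀ A B n N → A * B * (n * N) ≡ n * (B * (N * A))
    shape = solve-∀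
  regroup : n ^ Q * (c ^ Q * n ^ P) ^ t ≡ (n * c ^ t) ^ Q * n ^ (P * t)
  regroup = begin-equality
    n ^ Q * (c ^ Q * n ^ P) ^ t         ≡⟨ cong (n ^ Q *_) (^-distribʳ-* (c ^ Q) (n ^ P) t) ⟩
    n ^ Q * ((c ^ Q) ^ t * (n ^ P) ^ t) ≡⟨ cong₂ (λ x y → n ^ Q * (x * y)) (^-comm c Q t) (^-*-assoc n P t) ⟩
    n ^ Q * ((c ^ t) ^ Q * n ^ (P * t)) ≡⟨ *-assoc (n ^ Q) _ _ ⟨
    n ^ Q * (c ^ t) ^ Q * n ^ (P * t)   ≡⟨ cong (_* n ^ (P * t)) (^-distribʳ-* n (c ^ t) Q) ⟨
    (n * c ^ t) ^ Q * n ^ (P * t)       ∎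

-- If the term t²N dominates n·Y, cancelling N leaves n^(Q - Pt) ≤ (2t²)^Q < n, which is
-- absurd as Pt < Q; otherwise n·Y + t²N ≤ 2nY, and 2^Q ≤ n ≤ n^t absorbs the factor 2.
density-increment : ∀ n N Y t P Q .{{_ : NonZero n}} .{{_ : NonZero N}} .{{_ : NonZero t}} →
  (2 * t * t) ^ Q < n → P * t < Q →
  (n * N) ^ Q ≤ (n * Y + t * t * N) ^ Q * n ^ (P * t) →
  N ^ Q ≤ Y ^ Q * n ^ (t + P * t)
density-increment n N Y t P Q n-large Pt<Q bound with t * t * N ≤? n * Y
... | yes tail≤ = begin
  N ^ Q                         ≤⟨ ^-cancelˡ-≤ n (n ^ (P * t)) Q (≤-trans bound (*-monoˡ-≤ _ (^-monoˡ-≤ Q Z≤))) ⟩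
  (2 * Y) ^ Q * n ^ (P * t)     ≡⟨ cong (_* n ^ (P * t)) (^-distribʳ-* 2 Y Q) ⟩
  2 ^ Q * Y ^ Q * n ^ (P * t)   ≤⟨ *-monoˡ-≤ (n ^ (P * t)) (*-monoˡ-≤ (Y ^ Q) 2^Q≤n^t) ⟩
  n ^ t * Y ^ Q * n ^ (P * t)   ≡⟨ cong (_* n ^ (P * t)) (*-comm (n ^ t) (Y ^ Q)) ⟩
  Y ^ Q * n ^ t * n ^ (P * t)   ≡⟨ *-assoc (Y ^ Q) _ _ ⟩
  Y ^ Q * (n ^ t * n ^ (P * t)) ≡⟨ cong (Y ^ Q *_) (^-distribˡ-+-* n t (P * t)) ⟨
  Y ^ Q * n ^ (t + P * t)       ∎
  where
  open ≤-Reasoning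
  Z≤ : n * Y + t * t * N ≤ n * (2 * Y)
  Z≤ = ≤-trans (+-monoʳ-≤ (n * Y) tail≤) (≤-reflexive (shape n Y))
    where
    shape : ∀ n Y → n * Y + n * Y ≡ n * (2 * Y)
    shape = solve-∀
  2^Q≤n^t : 2 ^ Q ≤ n ^ t
  2^Q≤n^t = begin
    2 ^ Q            ≤⟨ ^-monoˡ-≤ Q (≤-trans (m≤m*n 2 t) (m≤m*n (2 * t) t)) ⟩
    (2 * t * t) ^ Q  ≤⟨ <⇒≤ n-large ⟩
    n                ≤⟨ m≤m^n n t ⟩
    n ^ t            ∎
... | no tail≰ with m≤n⇒∃[o]m+o≡n Pt<Q
...   | o , refl = contradiction (≤-trans (m≤m^n n (suc o)) n^1+o≤T^Q) (<⇒≱ n-large)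
  where
  open ≤-Reasoning
  T : ℕ
  T = 2 * t * t
  Z≤ : n * Y + t * t * N ≤ N * T
  Z≤ = ≤-trans (+-monoˡ-≤ (t * t * N) (<⇒≤ (≰⇒> tail≰))) (≤-reflexive (shape t N))
    where
    shape : ∀ t N → t * t * N + t * t * N ≡ N * (2 * t * t)
    shape = solve-∀
  n^Q≤T^Qn^Pt : n ^ Q ≤ T ^ Q * n ^ (P * t)
  n^Q≤T^Qn^Pt = ^-cancelˡ-≤ N (n ^ (P * t)) Q (begin
    (N * n) ^ Q                           ≡⟨ cong (_^ Q) (*-comm N n) ⟩
    (n * N) ^ Q                           ≤⟨ bound ⟩
    (n * Y + t * t * N) ^ Q * n ^ (P * t) ≤⟨ *-monoˡ-≤ (n ^ (P * t)) (^-monoˡ-≤ Q Z≤) ⟩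
    (N * T) ^ Q * n ^ (P * t)             ∎)
  n^1+o≤T^Q : n ^ suc o ≤ T ^ Q
  n^1+o≤T^Q = *-cancelˡ-≤ (n ^ (P * t)) {{m^n≢0 n (P * t)}} (begin
    n ^ (P * t) * n ^ suc o  ≡⟨ ^-distribˡ-+-* n (P * t) (suc o) ⟨
    n ^ (P * t + suc o)      ≡⟨ cong (n ^_) (+-suc (P * t) o) ⟩
    n ^ Q                    ≤⟨ n^Q≤T^Qn^Pt ⟩
    T ^ Q * n ^ (P * t)      ≡⟨ *-comm (T ^ Q) _ ⟩
    n ^ (P * t) * T ^ Q      ∎)

-- A copy of the complete ℓ-partite ℓ-graph K(t, …, t) inside S ⊆ [n]^ℓ: row a consists of
-- t distinct vertices, and every transversal of the rows lies in S.
record Box {n ℓ} (t : ℕ) (S : Vec (Fin n) ℓ → Bool) : Set where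
  field
    entry           : Fin ℓ → Fin t → Fin n
    entry-injective : ∀ a → Injective _≡_ _≡_ (entry a)
    transversal∈S   : ∀ (σ : Fin ℓ → Fin t) → S (tabulate λ a → entry a (σ a)) ≡ true

link : ∀ {n ℓ t} → (Vec (Fin n) (suc ℓ) → Bool) → Vec (Fin n) t → Vec (Fin n) ℓ → Bool
link S τ x = allᵇ (λ a → S (a ∷ x)) τ

box-[] : ∀ {n t} {S : Vec (Fin n) 0 → Bool} → S [] ≡ true → Box t S
box-[] []∈S = record { entry = λ () ; entry-injective = λ () ; transversal∈S = λ _ → []∈S }

box-∷ : ∀ {n ℓ t} {S : Vec (Fin n) (suc ℓ) → Bool} (τ : Vec (Fin n) t) →
        distinctᵇ τ ≡ true → Box t (link S τ) → Box t S
box-∷ {n} {ℓ} {t} τ τ-distinct B = record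
  { entry           = entry′
  ; entry-injective = entry′-injective
  ; transversal∈S   = λ σ → allᵇ-lookup _ τ (transversal∈S (σ ∘ suc)) (σ zero)
  }
  where
  open Box B
  entry′ : Fin (suc ℓ) → Fin t → Fin n
  entry′ zero    = lookup τ
  entry′ (suc a) = entry a
  entry′-injective : ∀ a → Injective _≡_ _≡_ (entry′ a)
  entry′-injective zero    = distinctᵇ⇒injective τ τ-distinct
  entry′-injective (suc a) = entry-injective a

module _ (n s Q : ℕ) (n-large : (2 * suc s * suc s) ^ Q < n) where

  private
    t : ℕ
    t = suc s
    instance
      n≢0 : NonZero n
      n≢0 = >-nonZero (≤-trans (s≤s z≤n) n-large)

  module Links {ℓ} (S : Vec (Fin n) (suc ℓ) → Bool) where

    degree : Vec (Fin n) ℓ → ℕ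
    degree x = ∑[ a ← allFin n ] 𝟙 (S (a ∷ x))

    count≡∑degree : count S ≡ ∑ (tuples n ℓ) degree
    count≡∑degree = trans (∑-cartesianProductWith _∷_ (allFin n) (tuples n ℓ) _)
                          (∑-comm (allFin n) (tuples n ℓ) λ a x → 𝟙 (S (a ∷ x)))

    ∑degree^t : ∑[ x ← tuples n ℓ ] degree x ^ t ≡ ∑[ τ ← tuples n t ] count (link S τ)
    ∑degree^t = trans (∑-cong (tuples n ℓ) λ x → sym (count-allᵇ t λ a → S (a ∷ x)))
                      (∑-comm (tuples n ℓ) (tuples n t) λ x τ → 𝟙 (link S τ x))

    repeating : ℕ
    repeating = count {n} {t} (not ∘ distinctᵇ)

    weight : Vec (Fin n) t → ℕ
    weight τ = 𝟙 (distinctᵇ τ) * count (link S τ)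

    best : Vec (Fin n) t
    best = proj₁ (∃-≥-average (replicate t (fromℕ< (>-nonZero⁻¹ n))) (tuples n t) weight)

    ∑count-link≤ : ∑[ τ ← tuples n t ] count (link S τ) ≤ n ^ t * weight best + repeating * n ^ ℓ
    ∑count-link≤ = begin
      ∑[ τ ← tuples n t ] count (link S τ)
        ≤⟨ ∑-mono-≤ (tuples n t) split ⟩
      ∑[ τ ← tuples n t ] (weight τ + 𝟙 (not (distinctᵇ τ)) * n ^ ℓ)
        ≡⟨ ∑-distrib-+ (tuples n t) _ _ ⟩
      ∑ (tuples n t) weight + (∑[ τ ← tuples n t ] 𝟙 (not (distinctᵇ τ)) * n ^ ℓ)
        ≡⟨ cong (∑ (tuples n t) weight +_) (∑-*ʳ (tuples n t) (n ^ ℓ) _) ⟩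
      ∑ (tuples n t) weight + repeating * n ^ ℓ
        ≤⟨ +-monoˡ-≤ _ (proj₂ (∃-≥-average _ (tuples n t) weight)) ⟩
      length (tuples n t) * weight best + repeating * n ^ ℓ
        ≡⟨ cong (λ m → m * weight best + repeating * n ^ ℓ) (length-tuples n t) ⟩
      n ^ t * weight best + repeating * n ^ ℓ ∎
      where
      open ≤-Reasoning
      split : ∀ τ → count (link S τ) ≤ weight τ + 𝟙 (not (distinctᵇ τ)) * n ^ ℓ
      split τ with distinctᵇ τ
      ... | true  = ≤-reflexive (trans (sym (+-identityʳ _)) (sym (+-identityʳ _)))
      ... | false = ≤-trans (count≤ (link S τ)) (≤-reflexive (sym (+-identityʳ _)))

    link-bound : n * count S ^ t ≤ (n ^ ℓ) ^ s * n ^ t * (n * weight best + t * t * n ^ ℓ)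
    link-bound = begin
      n * count S ^ t
        ≡⟨ cong (λ c → n * c ^ t) count≡∑degree ⟩
      n * (∑ (tuples n ℓ) degree) ^ t
        ≤⟨ *-monoʳ-≤ n (power-mean s (tuples n ℓ) degree) ⟩
      n * (length (tuples n ℓ) ^ s * (∑[ x ← tuples n ℓ ] degree x ^ t))
        ≡⟨ cong₂ (λ L D → n * (L ^ s * D)) (length-tuples n ℓ) ∑degree^t ⟩
      n * (N ^ s * (∑[ τ ← tuples n t ] count (link S τ)))
        ≤⟨ *-monoʳ-≤ n (*-monoʳ-≤ (N ^ s) ∑count-link≤) ⟩
      n * (N ^ s * (n ^ t * Y + repeating * N))
        ≡⟨ regroup n (N ^ s) (n ^ t) Y repeating N ⟩
      N ^ s * (n ^ t * (n * Y) + n * repeating * N)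
        ≤⟨ *-monoʳ-≤ (N ^ s) (+-monoʳ-≤ _ (*-monoˡ-≤ N (count-repeating n t))) ⟩
      N ^ s * (n ^ t * (n * Y) + t * t * n ^ t * N)
        ≡⟨ factor (N ^ s) (n ^ t) (n * Y) (t * t) N ⟩
      N ^ s * n ^ t * (n * Y + t * t * N) ∎
      where
      open ≤-Reasoning
      N Y : ℕ
      N = n ^ ℓ
      Y = weight best
      regroup : ∀ n A B Y R N → n * (A * (B * Y + R * N)) ≡ A * (B * (n * Y) + n * R * N)
      regroup = solve-∀
      factor : ∀ A B C T N → A * (B * C + T * B * N) ≡ A * B * (C + T * N)
      factor = solve-∀

  budget⇒Q≢0 : ∀ {ℓ P} → (2 * t) ^ ℓ * suc P ≤ Q → NonZero Q
  budget⇒Q≢0 {ℓ} {P} budget =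
    >-nonZero (≤-trans (>-nonZero⁻¹ _ {{m*n≢0 ((2 * t) ^ ℓ) (suc P) {{m^n≢0 (2 * t) ℓ}}}}) budget)

  budget-split : ∀ ℓ P → (2 * t) ^ suc ℓ * suc P ≤ Q → P * t < Q × (2 * t) ^ ℓ * suc (t + P * t) ≤ Q
  budget-split ℓ P budget = Pt<Q , budget′
    where
    open ≤-Reasoning
    b : ℕ
    b = (2 * t) ^ ℓ
    instance
      b≢0 : NonZero b
      b≢0 = m^n≢0 (2 * t) ℓ
    Pt<Q : P * t < Q
    Pt<Q = begin-strict
      P * t                    <⟨ m<n+m (P * t) z<s ⟩
      t + P * t                ≡⟨ *-comm (suc P) t ⟩
      t * suc P                ≤⟨ *-monoˡ-≤ (suc P) (≤-trans (m≤n*m t 2) (m≤m*n (2 * t) b)) ⟩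
      (2 * t) ^ suc ℓ * suc P  ≤⟨ budget ⟩
      Q                        ∎
    budget′ : b * suc (t + P * t) ≤ Q
    budget′ = begin
      b * suc (t + P * t)              ≤⟨ *-monoʳ-≤ b (+-monoˡ-≤ (t + P * t) 1≤t+Pt) ⟩
      b * ((t + P * t) + (t + P * t))  ≡⟨ regroup b t P ⟩
      (2 * t) ^ suc ℓ * suc P          ≤⟨ budget ⟩
      Q                                ∎
      where
      1≤t+Pt : 1 ≤ t + P * t
      1≤t+Pt = m≤m+n (suc zero) (s + P * t)
      regroup : ∀ b t P → b * ((t + P * t) + (t + P * t)) ≡ 2 * t * b * suc P
      regroup = solve-∀

  -- Erdős's box theorem: if S has density at least n^(-P/Q) and the exponent budget
  -- (2t)^ℓ (P + 1) ≤ Q suffices for ℓ density increments P ↦ t (P + 1), then S contains a box.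
  box : ∀ ℓ P (S : Vec (Fin n) ℓ → Bool) → (2 * t) ^ ℓ * suc P ≤ Q →
        (n ^ ℓ) ^ Q ≤ count S ^ Q * n ^ P → Box t S
  box zero P S budget dense = box-[] (𝟙>0⇒true (S []) (subst (0 <_) (+-identityʳ _) []∈S))
    where
    []∈S : 0 < count S
    []∈S = positive-base (count S) (n ^ P) Q {{m^n≢0 1 Q}} {{budget⇒Q≢0 {0} {P} budget}} dense
  box (suc ℓ) P S budget dense =
    box-∷ best best-distinct (box ℓ (t + P * t) (link S best) (proj₂ split) best-dense)
    where
    open Links S
    N : ℕ
    N = n ^ ℓ
    instance
      N≢0 : NonZero N
      N≢0 = m^n≢0 n ℓ
    split : P * t < Q × (2 * t) ^ ℓ * suc (t + P * t) ≤ Q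
    split = budget-split ℓ P budget
    increment : N ^ Q ≤ weight best ^ Q * n ^ (t + P * t)
    increment = density-increment n N (weight best) t P Q n-large (proj₁ split)
                  (link-density n N (count S) (weight best) s P Q dense link-bound)
    positive : 0 < 𝟙 (distinctᵇ best) * count (link S best)
    positive = positive-base _ _ Q {{m^n≢0 N Q}} {{budget⇒Q≢0 {suc ℓ} {P} budget}} increment
    best-distinct : distinctᵇ best ≡ true
    best-distinct with distinctᵇ best | positive
    ... | true  | _  = refl
    ... | false | ()
    best-dense : (n ^ ℓ) ^ Q ≤ count (link S best) ^ Q * n ^ (t + P * t)
    best-dense = subst (λ y → N ^ Q ≤ y ^ Q * n ^ (t + P * t))
                       (trans (cong (λ b → 𝟙 b * count (link S best)) best-distinct) (*-identityˡ _))
                       increment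

module _ {a b} (φ : Fin a → Fin b) where

  ∃-preimage? : ∀ p j → Dec (∃ λ i → i ∈ p × φ i ≡ j)
  ∃-preimage? p j = any? λ i → (i ∈? p) ×-dec (φ i ≟ j)

  lookup-image : ∀ p j → lookup (image φ p) j ≡ does (∃-preimage? p j)
  lookup-image p j = trans (lookup∘tabulate _ j) (isYes≗does (∃-preimage? p j))

  ∈-image⁻ : ∀ {p j} → j ∈ image φ p → ∃ λ i → i ∈ p × φ i ≡ j
  ∈-image⁻ {p} {j} j∈ = does⇒witness (∃-preimage? p j) (trans (sym (lookup-image p j)) ([]=⇒lookup j∈))

  ∈-image⁺ : ∀ {p i j} → i ∈ p → φ i ≡ j → j ∈ image φ p
  ∈-image⁺ {p} {i} {j} i∈p refl =
    lookup⇒[]= j (image φ p) (trans (lookup-image p j) (dec-true (∃-preimage? p j) (i , i∈p , refl)))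

  preimage : Subset b → Subset a
  preimage q = tabulate (λ i → lookup q (φ i))

  ∈-preimage⁻ : ∀ {q i} → i ∈ preimage q → φ i ∈ q
  ∈-preimage⁻ {q} {i} i∈ = lookup⇒[]= (φ i) q (trans (sym (lookup∘tabulate _ i)) ([]=⇒lookup i∈))

  ∈-preimage⁺ : ∀ {q i} → φ i ∈ q → i ∈ preimage q
  ∈-preimage⁺ {q} {i} φi∈ = lookup⇒[]= i (preimage q) (trans (lookup∘tabulate _ i) ([]=⇒lookup φi∈))

  image-preimage : ∀ {q} → (∀ {j} → j ∈ q → ∃ λ i → φ i ≡ j) → image φ (preimage q) ≡ q
  image-preimage {q} q⊆range = ⊆-antisym
    (λ j∈ → let i , i∈ , φi≡j = ∈-image⁻ j∈ in subst (_∈ q) φi≡j (∈-preimage⁻ i∈))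
    (λ j∈ → let i , φi≡j = q⊆range j∈ in ∈-image⁺ (∈-preimage⁺ (subst (_∈ q) (sym φi≡j) j∈)) φi≡j)

  preimage-image : Injective _≡_ _≡_ φ → ∀ p → preimage (image φ p) ≡ p
  preimage-image φ-inj p = ⊆-antisym
    (λ i∈ → let i′ , i′∈p , φi′≡φi = ∈-image⁻ (∈-preimage⁻ i∈) in subst (_∈ p) (φ-inj φi′≡φi) i′∈p)
    (λ i∈p → ∈-preimage⁺ (∈-image⁺ i∈p refl))

image-cong : ∀ {a b} {φ ψ : Fin a → Fin b} p → (∀ {i} → i ∈ p → φ i ≡ ψ i) → image φ p ≡ image ψ p
image-cong {φ = φ} {ψ} p φ≗ψ = ⊆-antisym
  (λ j∈ → let i , i∈p , φi≡j = ∈-image⁻ φ j∈ in ∈-image⁺ ψ i∈p (trans (sym (φ≗ψ i∈p)) φi≡j))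
  (λ j∈ → let i , i∈p , ψi≡j = ∈-image⁻ ψ j∈ in ∈-image⁺ φ i∈p (trans (φ≗ψ i∈p) ψi≡j))

image-∘ : ∀ {a b c} (ψ : Fin b → Fin c) (φ : Fin a → Fin b) p → image (ψ ∘ φ) p ≡ image ψ (image φ p)
image-∘ ψ φ p = ⊆-antisym
  (λ k∈ → let i , i∈p , eq = ∈-image⁻ (ψ ∘ φ) k∈ in ∈-image⁺ ψ (∈-image⁺ φ i∈p refl) eq)
  (λ k∈ → let j , j∈ , eq = ∈-image⁻ ψ k∈
              i , i∈p , eq′ = ∈-image⁻ φ j∈
          in ∈-image⁺ (ψ ∘ φ) i∈p (trans (cong ψ eq′) eq))

∣p∪q∣≤∣p∣+∣q∣ : ∀ {n} (p q : Subset n) → ∣ p ∪ q ∣ ≤ ∣ p ∣ + ∣ q ∣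
∣p∪q∣≤∣p∣+∣q∣ []          []          = z≤n
∣p∪q∣≤∣p∣+∣q∣ (true ∷ p)  (s ∷ q)     = s≤s (≤-trans (∣p∪q∣≤∣p∣+∣q∣ p q) (+-monoʳ-≤ ∣ p ∣ (∣p∣≤∣x∷p∣ s q)))
∣p∪q∣≤∣p∣+∣q∣ (false ∷ p) (true ∷ q)  = ≤-trans (s≤s (∣p∪q∣≤∣p∣+∣q∣ p q)) (≤-reflexive (sym (+-suc ∣ p ∣ ∣ q ∣)))
∣p∪q∣≤∣p∣+∣q∣ (false ∷ p) (false ∷ q) = ∣p∪q∣≤∣p∣+∣q∣ p q

∣image∣≤∣p∣ : ∀ {a b} (φ : Fin a → Fin b) p → ∣ image φ p ∣ ≤ ∣ p ∣
∣image∣≤∣p∣ {zero} {b} φ [] = ≤-trans (p⊆q⇒∣p∣≤∣q∣ image⊆) (≤-reflexive (∣⊥∣≡0 b))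
  where
  image⊆ : image φ [] ⊆ ⊥
  image⊆ j∈ = ⊥-elim (¬Fin0 (proj₁ (∈-image⁻ φ {p = []} j∈)))
∣image∣≤∣p∣ {suc a} φ (false ∷ p) = ≤-trans (p⊆q⇒∣p∣≤∣q∣ image⊆) (∣image∣≤∣p∣ (φ ∘ suc) p)
  where
  image⊆ : image φ (false ∷ p) ⊆ image (φ ∘ suc) p
  image⊆ j∈ with ∈-image⁻ φ j∈
  ... | suc i , there i∈p , φi≡j = ∈-image⁺ (φ ∘ suc) i∈p φi≡j
∣image∣≤∣p∣ {suc a} φ (true ∷ p) = begin
  ∣ image φ (true ∷ p) ∣                      ≤⟨ p⊆q⇒∣p∣≤∣q∣ image⊆ ⟩
  ∣ ⁅ φ zero ⁆ ∪ image (φ ∘ suc) p ∣          ≤⟨ ∣p∪q∣≤∣p∣+∣q∣ ⁅ φ zero ⁆ _ ⟩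
  ∣ ⁅ φ zero ⁆ ∣ + ∣ image (φ ∘ suc) p ∣      ≡⟨ cong (_+ ∣ image (φ ∘ suc) p ∣) (∣⁅x⁆∣≡1 (φ zero)) ⟩
  suc ∣ image (φ ∘ suc) p ∣                   ≤⟨ s≤s (∣image∣≤∣p∣ (φ ∘ suc) p) ⟩
  suc ∣ p ∣                                   ∎
  where
  open ≤-Reasoning
  image⊆ : image φ (true ∷ p) ⊆ ⁅ φ zero ⁆ ∪ image (φ ∘ suc) p
  image⊆ j∈ with ∈-image⁻ φ j∈
  ... | zero  , here       , refl  = x∈p∪q⁺ (inj₁ (x∈⁅x⁆ (φ zero)))
  ... | suc i , there i∈p , φi≡j = x∈p∪q⁺ (inj₂ (∈-image⁺ (φ ∘ suc) i∈p φi≡j))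

∣image∣<∣p∣ : ∀ {a b} (φ : Fin a → Fin b) {p x y} →
              x ∈ p → y ∈ p → x ≢ y → φ x ≡ φ y → ∣ image φ p ∣ < ∣ p ∣
∣image∣<∣p∣ φ {p} {x} {y} x∈p y∈p x≢y φx≡φy = begin-strict
  ∣ image φ p ∣        ≤⟨ p⊆q⇒∣p∣≤∣q∣ image⊆ ⟩
  ∣ image φ (p - y) ∣  ≤⟨ ∣image∣≤∣p∣ φ (p - y) ⟩
  ∣ p - y ∣            <⟨ x∈p⇒∣p-x∣<∣p∣ y∈p ⟩
  ∣ p ∣                ∎
  where
  open ≤-Reasoning
  image⊆ : image φ p ⊆ image φ (p - y)
  image⊆ j∈ with ∈-image⁻ φ j∈
  ... | i , i∈p , φi≡j with i ≟ y
  ...   | yes refl = ∈-image⁺ φ (x∈p∧x≢y⇒x∈p-y x∈p x≢y) (trans φx≡φy φi≡j)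
  ...   | no  i≢y  = ∈-image⁺ φ (x∈p∧x≢y⇒x∈p-y i∈p i≢y) φi≡j

IsHom-resp-≗ : ∀ {k} {F G : KGraph k} {φ ψ : Fin (v F) → Fin (v G)} →
               (∀ x → φ x ≡ ψ x) → IsHom F G φ → IsHom F G ψ
IsHom-resp-≗ {G = G} φ≗ψ φ-hom e e∈F =
  subst (λ f → edge G f ≡ true) (image-cong e λ {x} _ → φ≗ψ x) (φ-hom e e∈F)

hom-injective-on-edges : ∀ {k} {F L : KGraph k} {h} → IsHom F L h →
  ∀ {e} → edge F e ≡ true → ∀ {x y} → x ∈ e → y ∈ e → h x ≡ h y → x ≡ y
hom-injective-on-edges {F = F} {L} {h} hom {e} e∈F {x} {y} x∈e y∈e hx≡hy with x ≟ y
... | yes x≡y = x≡y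
... | no  x≢y = contradiction (∣image∣<∣p∣ h x∈e y∈e x≢y hx≡hy)
                  (<-irrefl (trans (uniform L _ (hom e e∈F)) (sym (uniform F e e∈F))))

module _ {k} {L G : KGraph k} where

  embedding : Copy L G → Fin (v L) → Fin (v G)
  embedding (_ , φ , _) = φ

  copy-injective : (c : Copy L G) → Injective _≡_ _≡_ (embedding c)
  copy-injective (_ , _ , φ-inj , _) = φ-inj

  copy⇒IsHom : (c : Copy L G) → IsHom L G (embedding c)
  copy⇒IsHom (H , φ , _ , _ , edges) e e∈L = E'⊆E H (image φ e) (trans (sym (edges e)) e∈L)

  private
    W-⊆ : (c₁ c₂ : Copy L G) → (∀ i → embedding c₁ i ≡ embedding c₂ i) → W (proj₁ c₁) ⊆ W (proj₁ c₂)
    W-⊆ (_ , _ , _ , W₁ , _) (_ , _ , _ , W₂ , _) φ₁≗φ₂ {x} x∈W₁ =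
      let i , φ₁i≡x = Equivalence.to (W₁ x) x∈W₁ in Equivalence.from (W₂ x) (i , trans (sym (φ₁≗φ₂ i)) φ₁i≡x)

    E'-⇒ : (c₁ c₂ : Copy L G) → (∀ i → embedding c₁ i ≡ embedding c₂ i) →
           ∀ f → E' (proj₁ c₁) f ≡ true → E' (proj₁ c₂) f ≡ true
    E'-⇒ (H₁ , φ₁ , _ , W₁ , edges₁) (H₂ , φ₂ , _ , _ , edges₂) φ₁≗φ₂ f f∈H₁ = begin
      E' H₂ f             ≡⟨ cong (E' H₂) f≡ ⟨
      E' H₂ (image φ₁ e)  ≡⟨ cong (E' H₂) (image-cong e (λ {i} _ → φ₁≗φ₂ i)) ⟩
      E' H₂ (image φ₂ e)  ≡⟨ edges₂ e ⟨
      edge L e            ≡⟨ edges₁ e ⟩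
      E' H₁ (image φ₁ e)  ≡⟨ cong (E' H₁) f≡ ⟩
      E' H₁ f             ≡⟨ f∈H₁ ⟩
      true                ∎
      where
      open ≡-Reasoning
      e : Subset (v L)
      e = preimage φ₁ f
      f≡ : image φ₁ e ≡ f
      f≡ = image-preimage φ₁ (λ j∈f → Equivalence.to (W₁ _) (inside H₁ f f∈H₁ _ j∈f))

  same-embedding⇒SameSubgraph : (c₁ c₂ : Copy L G) → (∀ i → embedding c₁ i ≡ embedding c₂ i) →
                                SameSubgraph (proj₁ c₁) (proj₁ c₂)
  same-embedding⇒SameSubgraph c₁ c₂ φ₁≗φ₂ =
    ⊆-antisym (W-⊆ c₁ c₂ φ₁≗φ₂) (W-⊆ c₂ c₁ φ₂≗φ₁) ,
    λ f → ⇔→≡ (mk⇔ (E'-⇒ c₁ c₂ φ₁≗φ₂ f) (E'-⇒ c₂ c₁ φ₂≗φ₁ f))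
    where
    φ₂≗φ₁ : ∀ i → embedding c₂ i ≡ embedding c₁ i
    φ₂≗φ₁ i = sym (φ₁≗φ₂ i)

injective-hom⇒Copy : ∀ {k} {F G : KGraph k} (ψ : Fin (v F) → Fin (v G)) →
                     Injective _≡_ _≡_ ψ → IsHom F G ψ → Copy F G
injective-hom⇒Copy {F = F} {G} ψ ψ-inj ψ-hom = H , ψ , ψ-inj , (λ j → mk⇔ (range ⊆-refl) ∈range) , edges
  where
  range : ∀ {q} → q ⊆ image ψ ⊤ → ∀ {j} → j ∈ q → ∃ λ i → ψ i ≡ j
  range q⊆ j∈q = let i , _ , ψi≡j = ∈-image⁻ ψ (q⊆ j∈q) in i , ψi≡j
  ∈range : ∀ {j} → (∃ λ i → ψ i ≡ j) → j ∈ image ψ ⊤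
  ∈range (i , ψi≡j) = ∈-image⁺ ψ ∈⊤ ψi≡j
  Eψ : Subset (v G) → Bool
  Eψ q = edge F (preimage ψ q) ∧ does (q ⊆? image ψ ⊤)
  Eψ-sound : ∀ q → Eψ q ≡ true → edge F (preimage ψ q) ≡ true × q ⊆ image ψ ⊤
  Eψ-sound q q∈ with edge F (preimage ψ q) | q ⊆? image ψ ⊤
  ... | true | yes q⊆ = refl , q⊆
  H : Subgraph G
  H = record
    { W      = image ψ ⊤
    ; E'     = Eψ
    ; E'⊆E   = λ q q∈H → let e∈F , q⊆ = Eψ-sound q q∈H in
                 subst (λ f → edge G f ≡ true) (image-preimage ψ (range q⊆)) (ψ-hom _ e∈F)
    ; inside = λ q q∈H j → proj₂ (Eψ-sound q q∈H)
    }
  edges : ∀ e → edge F e ≡ Eψ (image ψ e)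
  edges e = begin
    edge F e                                       ≡⟨ ∧-identityʳ (edge F e) ⟨
    edge F e ∧ true                                ≡⟨ cong₂ _∧_ (cong (edge F) (preimage-image ψ ψ-inj e))
                                                                (dec-true (image ψ e ⊆? image ψ ⊤) image⊆) ⟨
    edge F (preimage ψ (image ψ e)) ∧ does (image ψ e ⊆? image ψ ⊤)  ∎
    where
    open ≡-Reasoning
    image⊆ : image ψ e ⊆ image ψ ⊤
    image⊆ j∈ = let i , _ , ψi≡j = ∈-image⁻ ψ j∈ in ∈-image⁺ ψ ∈⊤ ψi≡j


-- Vertex x of F goes to entry x + 1 of row h x; entry 0 of each row is a spare, used for
-- the rows that a given edge of F does not meet.
module _ {k} {F L G : KGraph k} (h : Fin (v F) → Fin (v L)) (h-hom : IsHom F L h)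
         (entry : Fin (v L) → Fin (suc (v F)) → Fin (v G))
         (entry-injective : ∀ a → Injective _≡_ _≡_ (entry a))
         (transversal-injective : ∀ (σ : Fin (v L) → Fin (suc (v F))) → Injective _≡_ _≡_ (λ a → entry a (σ a)))
         (transversal-hom : ∀ (σ : Fin (v L) → Fin (suc (v F))) → IsHom L G (λ a → entry a (σ a))) where

  blow-up : Fin (v F) → Fin (v G)
  blow-up x = entry (h x) (suc x)

  blow-up-injective : Injective _≡_ _≡_ blow-up
  blow-up-injective {x} {y} eq with h x ≟ h y
  ... | yes hx≡hy =
    Fin.suc-injective (entry-injective (h y) (subst (λ a → entry a (suc x) ≡ blow-up y) hx≡hy eq))
  ... | no  hx≢hy = contradiction (transversal-injective σ σhx≡σhy) hx≢hy
    where
    σ : Fin (v L) → Fin (suc (v F))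
    σ a = if does (a ≟ h x) then suc x else suc y
    σhx≡σhy : entry (h x) (σ (h x)) ≡ entry (h y) (σ (h y))
    σhx≡σhy = begin
      entry (h x) (σ (h x))  ≡⟨ cong (λ b → entry (h x) (if b then suc x else suc y))
                                     (dec-true (h x ≟ h x) refl) ⟩
      blow-up x              ≡⟨ eq ⟩
      blow-up y              ≡⟨ cong (λ b → entry (h y) (if b then suc x else suc y))
                                     (dec-false (h y ≟ h x) (hx≢hy ∘ sym)) ⟨
      entry (h y) (σ (h y))  ∎
      where open ≡-Reasoning

  blow-up-hom : IsHom F G blow-up
  blow-up-hom e e∈F =
    subst (λ f → edge G f ≡ true) (sym image≡) (transversal-hom slot (image h e) (h-hom e e∈F))
    where
    slot : Fin (v L) → Fin (suc (v F))
    slot a with ∃-preimage? h e a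
    ... | yes (x , _) = suc x
    ... | no  _       = zero
    slot-h : ∀ {x} → x ∈ e → slot (h x) ≡ suc x
    slot-h {x} x∈e with ∃-preimage? h e (h x)
    ... | yes (x′ , x′∈e , hx′≡hx) = cong suc (hom-injective-on-edges {F = F} {L} h-hom e∈F x′∈e x∈e hx′≡hx)
    ... | no  ∄x                   = contradiction (x , x∈e , refl) ∄x
    image≡ : image blow-up e ≡ image (λ a → entry a (slot a)) (image h e)
    image≡ = trans (image-cong e λ {x} x∈e → cong (entry (h x)) (sym (slot-h x∈e)))
                   (image-∘ (λ a → entry a (slot a)) h e)

  blow-up-copy : Copy F G
  blow-up-copy = injective-hom⇒Copy {F = F} blow-up blow-up-injective blow-up-hom

-- The box theorem runs ℓ ≤ f rounds starting from P = 1, and (2t)^ℓ · 2 ≤ 2 (2t)^f; the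
-- threshold is its size condition n > (2t²)^Q.
exponent : ℕ → ℕ
exponent f = 2 * (2 * suc f) ^ f

threshold : ℕ → ℕ
threshold f = suc ((2 * suc f * suc f) ^ exponent f)

many-copies⇒Copy : ∀ {k} {F L : KGraph k} → Hom F L → v L ≤ v F →
  ∀ {G : KGraph k} → threshold (v F) ≤ v G → ∀ {m} → AtLeastCopies m L G →
  v G ^ (v L * exponent (v F) ∸ 1) ≤ m ^ exponent (v F) → Copy F G
many-copies⇒Copy {F = F} {L} (h , h-hom) ℓ≤f {G} n-large {m} (copies , copies-distinct) many =
  blow-up-copy {F = F} {L} {G} h h-hom entry entry-injective transversal-injective transversal-hom
  where
  n ℓ Q : ℕ
  n = v G
  ℓ = v L
  Q = exponent (v F)
  instance
    n≢0 : NonZero n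
    n≢0 = >-nonZero (≤-trans (s≤s z≤n) n-large)
  φ : Fin m → Fin ℓ → Fin n
  φ i = embedding {L = L} (copies i)
  vertices : Fin m → Vec (Fin n) ℓ
  vertices i = tabulate (φ i)
  vertices-injective : Injective _≡_ _≡_ vertices
  vertices-injective {i} {j} eq =
    copies-distinct i j (same-embedding⇒SameSubgraph {L = L} (copies i) (copies j) (tabulate-injective eq))
  S : Vec (Fin n) ℓ → Bool
  S τ = does (any? λ i → ≡-dec _≟_ (vertices i) τ)
  m≤count : m ≤ count S
  m≤count = count-image (≡-dec _≟_) ∈-tuples m vertices vertices-injective
  dense : (n ^ ℓ) ^ Q ≤ count S ^ Q * n ^ 1
  dense = begin
    (n ^ ℓ) ^ Q          ≡⟨ ^-*-assoc n ℓ Q ⟩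
    n ^ (ℓ * Q)          ≤⟨ m^n≤m^[n∸1]*m n (ℓ * Q) ⟩
    n ^ (ℓ * Q ∸ 1) * n  ≤⟨ *-monoˡ-≤ n many ⟩
    m ^ Q * n            ≤⟨ *-monoˡ-≤ n (^-monoˡ-≤ Q m≤count) ⟩
    count S ^ Q * n      ≡⟨ cong (count S ^ Q *_) (*-identityʳ n) ⟨
    count S ^ Q * n ^ 1  ∎
    where open ≤-Reasoning
  budget : (2 * suc (v F)) ^ ℓ * 2 ≤ Q
  budget = ≤-trans (≤-reflexive (*-comm ((2 * suc (v F)) ^ ℓ) 2))
                   (*-monoʳ-≤ 2 (^-monoʳ-≤ (2 * suc (v F)) ℓ≤f))
  open Box (box n (v F) Q n-large ℓ 1 S budget dense)
  transversal-copy : ∀ σ → Σ (Fin m) λ i → ∀ a → φ i a ≡ entry a (σ a)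
  transversal-copy σ = let i , eq = does⇒witness (any? _) (transversal∈S σ) in i , tabulate-injective eq
  transversal-injective : ∀ σ → Injective _≡_ _≡_ (λ a → entry a (σ a))
  transversal-injective σ {a} {b} eq = let i , φi≗ = transversal-copy σ in
    copy-injective {L = L} (copies i) (trans (φi≗ a) (trans eq (sym (φi≗ b))))
  transversal-hom : ∀ σ → IsHom L G (λ a → entry a (σ a))
  transversal-hom σ = let i , φi≗ = transversal-copy σ in
    IsHom-resp-≗ {F = L} {G} φi≗ (copy⇒IsHom {L = L} (copies i))

lemma2p9 : ∀ {k} (F : KGraph k) →
    Σ ℕ λ C → Σ ℕ λ p → Σ ℕ λ q → NonZero p × NonZero q ×
    (∀ (L : KGraph k) → IsCore L F →
    ∀ (G : KGraph k) → C ≤ v G →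
    ∀ (m : ℕ) → AtLeastCopies m L G →
    v G ^ (v L * q ∸ p) ≤ m ^ q →
    Copy F G)
lemma2p9 F = threshold (v F) , 1 , exponent (v F) , _ , exponent≢0 ,
  λ L (F→L , L⊆F , _) G n-large m copies many →
    many-copies⇒Copy {F = F} {L} F→L (injective⇒≤ (copy-injective {L = L} L⊆F)) n-large copies many
  where
  exponent≢0 : NonZero (exponent (v F))
  exponent≢0 = m*n≢0 2 _ {{_}} {{m^n≢0 (2 * suc (v F)) (v F)}}
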